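{- Let $H$ be a bipartite graph with ${\rm hcf}_c(H)=1$ and ${\rm hcf}_\chi(H)=2$, and let $B^*$ be its bottlegraph. There exists $D_0$ (depending on $H$) such that the following holds for every integer $D'\ge D_0$ divisible by $|H|$. Let $a$ be an integer with $|a|\le|B^*|$ and let $G$ be a complete bipartite graph with vertex classes $U_1,U_2$ such that $|U_1|=D'+a$ and $|U_2|=D'-a$. Then $G$ contains a perfect $H$-packing.
   Context: An optimal colouring of $H$ is a proper colouring with $\chi(H)$ colours. For an optimal colouring $c$ with colour class sizes $x_1\le\dots\le x_\ell$, $\mathcal{D}(c):=\{x_{i+1}-x_i\}$; $\mathcal{D}(H)$ is the union over optimal colourings; ${\rm hcf}_\chi(H)$ is the highest common factor of the integers in $\mathcal{D}(H)$. ${\rm hcf}_c(H)$ is the highest common factor of the orders of the components of $H$. $\sigma(H)$ is the minimum over optimal colourings of the size of a smallest colour class; for $\chi(H)=2$ the bottlegraph $B^*$ is the complete bipartite graph with classes of sizes $\sigma(H)$ and $|H|-\sigma(H)$ (so $|B^*|=|H|$). A perfect $H$-packing is a collection of vertex-disjoint copies of $H$ covering all vertices. -}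

module Defs where

open import Data.Nat using (ℕ; zero; suc; _+_; _≤_; ∣_-_∣)
open import Data.Nat.Divisibility using (_∣_)
open import Data.Fin using (Fin)
import Data.Fin as F
open import Data.Fin.Subset using (Subset; _∈_) renaming (∣_∣ to size)
open import Data.Bool using (Bool; true; false; if_then_else_; _xor_)
open import Data.Product using (Σ; ∃; _×_; _,_)
open import Relation.Binary.PropositionalEquality using (_≡_; _≢_; refl)
open import Relation.Nullary using (¬_)

record Graph : Set where
  field
    order : ℕ
    adj   : Fin order → Fin order → Bool
    adj-sym   : ∀ u v → adj u v ≡ adj v u
    adj-irref : ∀ u → adj u u ≡ false
open Graph public

Edge : (H : Graph) → Fin (order H) → Fin (order H) → Set
Edge H u v = adj H u v ≡ true

count : {n : ℕ} → (Fin n → Bool) → ℕ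
count {zero}  f = 0
count {suc n} f = (if f F.zero then 1 else 0) + count (λ i → f (F.suc i))

Proper2 : (H : Graph) → (Fin (order H) → Bool) → Set
Proper2 H c = ∀ u v → Edge H u v → c u ≢ c v

-- chromatic number exactly 2: some edge, and a proper 2-colouring
Chi≡2 : Graph → Set
Chi≡2 H = (∃ λ u → ∃ λ v → Edge H u v) × (∃ λ c → Proper2 H c)

classDiff : (H : Graph) → (Fin (order H) → Bool) → ℕ
classDiff H c = ∣ count c - count (λ i → if c i then false else true) ∣

IsHCF : (ℕ → Set) → ℕ → Set
IsHCF P h = (∀ x → P x → h ∣ x) × (∀ d → (∀ x → P x → d ∣ x) → d ≤ h)

-- For χ(H) = 2: D(H) = { x₂ - x₁ : optimal (proper 2-)colourings }
InDH : Graph → ℕ → Set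
InDH H x = ∃ λ c → Proper2 H c × x ≡ classDiff H c

HcfChi : Graph → ℕ → Set
HcfChi H h = IsHCF (InDH H) h

data Walk (H : Graph) : Fin (order H) → Fin (order H) → Set where
  here : ∀ {u} → Walk H u u
  step : ∀ {u v w} → Edge H u v → Walk H v w → Walk H u w

IsComponent : (H : Graph) → Subset (order H) → Set
IsComponent H S =
  (∃ λ v → v ∈ S)
  × (∀ u w → u ∈ S → Edge H u w → w ∈ S)
  × (∀ u w → u ∈ S → w ∈ S → Walk H u w)

ComponentOrder : Graph → ℕ → Set
ComponentOrder H x = ∃ λ S → IsComponent H S × x ≡ size S

HcfC : Graph → ℕ → Set
HcfC H h = IsHCF (ComponentOrder H) h

-- complete bipartite graph with classes {0..p-1} and {p..p+q-1}
inFirst : {p q : ℕ} → Fin (p + q) → Bool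
inFirst {zero}  i = false
inFirst {suc p} F.zero = true
inFirst {suc p} (F.suc i) = inFirst {p} i

xor-comm' : ∀ x y → x xor y ≡ y xor x
xor-comm' true  true  = refl
xor-comm' true  false = refl
xor-comm' false true  = refl
xor-comm' false false = refl

xor-same' : ∀ x → x xor x ≡ false
xor-same' true  = refl
xor-same' false = refl

K : ℕ → ℕ → Graph
K p q = record
  { order = p + q
  ; adj = λ u v → inFirst {p} {q} u xor inFirst {p} {q} v
  ; adj-sym = λ u v → xor-comm' (inFirst {p} {q} u) (inFirst {p} {q} v)
  ; adj-irref = λ u → xor-same' (inFirst {p} {q} u)
  }

-- A perfect H-packing of G: k vertex-disjoint copies of H (injective
-- edge-preserving maps) whose images cover V(G).
PerfectPacking : Graph → Graph → Set
PerfectPacking H G =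
  Σ ℕ λ k → Σ (Fin k → Fin (order H) → Fin (order G)) λ f →
    (∀ i u v → Edge H u v → Edge G (f i u) (f i v))
    × (∀ i j u v → f i u ≡ f j v → (i ≡ j) × (u ≡ v))
    × (∀ w → ∃ λ i → ∃ λ u → f i u ≡ w)

-- A proper 2-colouring of H with colour classes of sizes A and B is a copy of H in K(A, B), so a
-- list of proper colourings packs K(ΣAᵢ, ΣBᵢ) perfectly. Complementing a colouring negates its
-- excess A - B, hence K(D′ + a, D′ - a) has a perfect packing as soon as 2a is a signed sum of
-- exactly 2D′/|H| excesses. Since hcf_χ(H) = 2, Bézout writes 2 as a signed sum of some N
-- excesses. As hcf_c(H) = 1, some component has odd order; flipping the colours on it gives
-- colourings c, d with A_c + A_d odd. Since A_c + B_c = A_d + B_d, the excess of c minus that of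
-- d plus A_d - A_c copies of the sum for 2 is zero, and this zero sum has 2 + |A_d - A_c|·N ≡ N
-- (mod 2) terms; appending it to the sum for 2 gives one with an even number 2e of terms. Then 2a
-- is a sum of 2|a|e terms, and complementary pairs c, -c pad it to 2D′/|H| terms once D′ ≥ e|H|².
module Submission where

open import Defs
open import Data.Nat as ℕ using (ℕ; zero; suc; _≤_; parity)
import Data.Nat.Properties as ℕ
open import Data.Nat.Divisibility using (_∣_; divides; _∣0; ∣-refl; ∣-trans; ∣⇒≤; 0∣⇒≡0; ∣m∣n⇒∣m+n)
open import Data.Nat.GCD using (gcd; gcd-GCD; gcd[m,n]∣m; gcd[m,n]∣n; gcd-greatest; module GCD; module Bézout)
open import Data.Nat.ListAction using (sum)
open import Data.Nat.ListAction.Properties using (sum-++)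
open import Data.Integer using (ℤ; +_; -[1+_]; 0ℤ; _+_; _-_; -_; _*_; _⊖_; ∣_∣)
import Data.Integer.Properties as ℤ
open import Data.Integer.Solver using (module +-*-Solver)
open import Data.Parity.Base as ℙ using (0ℙ; 1ℙ)
import Data.Parity.Properties as ℙ
open import Algebra.Properties.CommutativeSemigroup ℙ.+-commutativeSemigroup using (interchange)
open import Algebra.Properties.CommutativeSemigroup ℕ.+-commutativeSemigroup using ()
  renaming (interchange to +-interchange)
open import Algebra.Properties.CommutativeSemigroup ℕ.*-commutativeSemigroup using ()
  renaming (xy∙z≈xz∙y to *-rightComm)
open import Data.Bool using (Bool; true; false; not; _xor_; if_then_else_)
import Data.Bool.Properties as Bool
open import Data.Fin using (Fin; zero; suc; _↑ˡ_; _↑ʳ_; splitAt; join; combine; remQuot)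
open import Data.Fin.Properties
  using (all?; nonZeroIndex; splitAt-↑ˡ; splitAt-↑ʳ; splitAt-join; join-splitAt; combine-injective; combine-remQuot)
open import Data.Fin.Subset using (Subset; _∈_) renaming (∣_∣ to size)
open import Data.Vec using ([]; _∷_; lookup)
open import Data.Vec.Properties using ([]=⇒lookup; lookup⇒[]=)
import Data.Vec.Functional as V
open import Data.List as List using (List; []; _∷_; _++_; [_]; length; map)
open import Data.List.Properties using (map-++; length-++; length-map)
open import Data.List.Relation.Unary.Any as Any using (Any; here; there)
import Data.List.Relation.Unary.Any.Properties as Any
open import Data.Sum as Sum using (_⊎_; inj₁; inj₂; [_,_]′)
open import Data.Product using (Σ; Σ-syntax; ∃-syntax; _×_; _,_; proj₁; proj₂)
open import Function using (_∘_; _∘₂_; id; const; mk⇔; _↔_; Inverse; mk↔ₛ′)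
open import Relation.Nullary using (Dec; yes; no; ¬?; contradiction)
open import Relation.Nullary.Decidable using (_→-dec_)
open import Relation.Binary.PropositionalEquality
  using (_≡_; _≢_; _≗_; refl; sym; trans; cong; cong₂; subst; subst₂; module ≡-Reasoning)

-- The summand of Defs.count, so that count f unfolds to indicator (f zero) + count (f ∘ suc).
indicator : Bool → ℕ
indicator b = if b then 1 else 0

count-cong : {N : ℕ} {f g : Fin N → Bool} → f ≗ g → count f ≡ count g
count-cong {zero}  f≗g = refl
count-cong {suc N} f≗g = cong₂ ℕ._+_ (cong indicator (f≗g zero)) (count-cong (f≗g ∘ suc))

count-↑ : (m : ℕ) {k : ℕ} (f : Fin (m ℕ.+ k) → Bool) →
          count f ≡ count (f ∘ (_↑ˡ k)) ℕ.+ count (f ∘ (m ↑ʳ_))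
count-↑ zero    f = refl
count-↑ (suc m) f = trans (cong (indicator (f zero) ℕ.+_) (count-↑ m (f ∘ suc)))
                          (sym (ℕ.+-assoc (indicator (f zero)) _ _))

count+count-not : {N : ℕ} (f : Fin N → Bool) → count f ℕ.+ count (not ∘ f) ≡ N
count+count-not {zero}  f = refl
count+count-not {suc N} f with f zero
... | true  = cong suc (count+count-not (f ∘ suc))
... | false = trans (ℕ.+-suc _ _) (cong suc (count+count-not (f ∘ suc)))

size≡count : {N : ℕ} (S : Subset N) → size S ≡ count (lookup S)
size≡count []          = refl
size≡count (true ∷ S)  = cong suc (size≡count S)
size≡count (false ∷ S) = size≡count S

parity-count-xor : {N : ℕ} (f g : Fin N → Bool) →
                   parity (count (λ i → f i xor g i)) ≡ parity (count f) ℙ.+ parity (count g)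
parity-count-xor {zero}  f g = refl
parity-count-xor {suc N} f g = begin
  parity (indicator (f zero xor g zero) ℕ.+ count (λ i → f (suc i) xor g (suc i)))
    ≡⟨ ℙ.+-homo-+ (indicator (f zero xor g zero)) _ ⟩
  parity (indicator (f zero xor g zero)) ℙ.+ parity (count (λ i → f (suc i) xor g (suc i)))
    ≡⟨ cong₂ ℙ._+_ (parity-indicator-xor (f zero) (g zero)) (parity-count-xor (f ∘ suc) (g ∘ suc)) ⟩
  (pf₀ ℙ.+ pg₀) ℙ.+ (parity (count (f ∘ suc)) ℙ.+ parity (count (g ∘ suc)))
    ≡⟨ interchange pf₀ pg₀ _ _ ⟩
  (pf₀ ℙ.+ parity (count (f ∘ suc))) ℙ.+ (pg₀ ℙ.+ parity (count (g ∘ suc)))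
    ≡⟨ sym (cong₂ ℙ._+_ (ℙ.+-homo-+ (indicator (f zero)) _) (ℙ.+-homo-+ (indicator (g zero)) _)) ⟩
  parity (count f) ℙ.+ parity (count g) ∎
  where
  open ≡-Reasoning
  pf₀ = parity (indicator (f zero))
  pg₀ = parity (indicator (g zero))
  parity-indicator-xor : ∀ x y → parity (indicator (x xor y)) ≡ parity (indicator x) ℙ.+ parity (indicator y)
  parity-indicator-xor true  true  = refl
  parity-indicator-xor true  false = refl
  parity-indicator-xor false y     = refl

parity-count+count-xor : {N : ℕ} (f g : Fin N → Bool) →
                         parity (count f ℕ.+ count (λ i → f i xor g i)) ≡ parity (count g)
parity-count+count-xor f g = begin
  parity (count f ℕ.+ count (λ i → f i xor g i))   ≡⟨ ℙ.+-homo-+ (count f) _ ⟩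
  p ℙ.+ parity (count (λ i → f i xor g i))         ≡⟨ cong (p ℙ.+_) (parity-count-xor f g) ⟩
  p ℙ.+ (p ℙ.+ parity (count g))                   ≡⟨ sym (ℙ.+-assoc p p _) ⟩
  (p ℙ.+ p) ℙ.+ parity (count g)                   ≡⟨ cong (ℙ._+ parity (count g)) (ℙ.p+p≡0ℙ p) ⟩
  parity (count g)                                 ∎
  where
  open ≡-Reasoning
  p = parity (count f)

parity≡0ℙ⇒2∣ : ∀ n → parity n ≡ 0ℙ → 2 ∣ n
parity≡0ℙ⇒2∣ zero          _    = 2 ∣0
parity≡0ℙ⇒2∣ (suc (suc n)) even = ∣m∣n⇒∣m+n (∣-refl {2}) (parity≡0ℙ⇒2∣ n even)

parity≡⇒2∣m+n : ∀ m n → parity m ≡ parity n → 2 ∣ m ℕ.+ n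
parity≡⇒2∣m+n m n pm≡pn =
  parity≡0ℙ⇒2∣ (m ℕ.+ n)
    (trans (ℙ.+-homo-+ m n) (trans (cong (ℙ._+ parity n) pm≡pn) (ℙ.p+p≡0ℙ (parity n))))

parity-∣m-n∣ : ∀ m n → parity ℕ.∣ m - n ∣ ≡ parity (m ℕ.+ n)
parity-∣m-n∣ zero    n       = refl
parity-∣m-n∣ (suc m) zero    = cong parity (sym (ℕ.+-identityʳ (suc m)))
parity-∣m-n∣ (suc m) (suc n) = trans (parity-∣m-n∣ m n) (cong (parity ∘ suc) (sym (ℕ.+-suc m n)))

∣m⊖n∣≡∣m-n∣ : ∀ m n → ∣ m ⊖ n ∣ ≡ ℕ.∣ m - n ∣
∣m⊖n∣≡∣m-n∣ zero    zero    = refl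
∣m⊖n∣≡∣m-n∣ zero    (suc n) = refl
∣m⊖n∣≡∣m-n∣ (suc m) zero    = refl
∣m⊖n∣≡∣m-n∣ (suc m) (suc n) = trans (cong ∣_∣ (ℤ.[1+m]⊖[1+n]≡m⊖n m n)) (∣m⊖n∣≡∣m-n∣ m n)

∣[+m]-[+n]∣≡∣m-n∣ : ∀ m n → ∣ + m - + n ∣ ≡ ℕ.∣ m - n ∣
∣[+m]-[+n]∣≡∣m-n∣ m n = trans (cong ∣_∣ (ℤ.[+m]-[+n]≡m⊖n m n)) (∣m⊖n∣≡∣m-n∣ m n)

xor-≢ : {x y : Bool} → x ≢ y → x xor y ≡ true
xor-≢ {true}  {true}  x≢y = contradiction refl x≢y
xor-≢ {true}  {false} x≢y = refl
xor-≢ {false} {true}  x≢y = refl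
xor-≢ {false} {false} x≢y = contradiction refl x≢y

xor-cancelʳ : ∀ {x y} s → x xor s ≡ y xor s → x ≡ y
xor-cancelʳ {x} {y} s eq = begin
  x                ≡⟨ sym (xor-involutiveʳ x) ⟩
  (x xor s) xor s  ≡⟨ cong (_xor s) eq ⟩
  (y xor s) xor s  ≡⟨ xor-involutiveʳ y ⟩
  y                ∎
  where
  open ≡-Reasoning
  xor-involutiveʳ : ∀ z → (z xor s) xor s ≡ z
  xor-involutiveʳ z = trans (Bool.xor-assoc z s s) (trans (cong (z xor_) (Bool.xor-same s)) (Bool.xor-identityʳ z))

bezout-combination : ∀ {d u p v q} → d ℕ.+ v ℕ.* q ≡ u ℕ.* p → + u * + p - + v * + q ≡ + d
bezout-combination {d} {u} {p} {v} {q} eq = begin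
  + u * + p - + v * + q            ≡⟨ cong₂ _-_ (sym (ℤ.pos-* u p)) (sym (ℤ.pos-* v q)) ⟩
  + (u ℕ.* p) - + (v ℕ.* q)        ≡⟨ cong (λ z → + z - + (v ℕ.* q)) (sym eq) ⟩
  + (d ℕ.+ v ℕ.* q) - + (v ℕ.* q)  ≡⟨ cong (_- + (v ℕ.* q)) (ℤ.pos-+ d (v ℕ.* q)) ⟩
  + d + + (v ℕ.* q) - + (v ℕ.* q)  ≡⟨ solve 2 (λ d w → d :+ w :- w := d) refl (+ d) (+ (v ℕ.* q)) ⟩
  + d                              ∎
  where
  open ≡-Reasoning
  open +-*-Solver

solve-sum-difference : ∀ {x y s a} → x + y ≡ s * + 2 → x - y ≡ a * + 2 → x ≡ s + a × y ≡ s - a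
solve-sum-difference {x} {y} {s} {a} sum≡ difference≡ = x≡ , y≡
  where
  open ≡-Reasoning
  open +-*-Solver
  x≡ : x ≡ s + a
  x≡ = ℤ.*-cancelʳ-≡ x (s + a) (+ 2) (begin
    x * + 2            ≡⟨ solve 2 (λ x y → x :* con (+ 2) := (x :+ y) :+ (x :- y)) refl x y ⟩
    (x + y) + (x - y)  ≡⟨ cong₂ _+_ sum≡ difference≡ ⟩
    s * + 2 + a * + 2  ≡⟨ sym (ℤ.*-distribʳ-+ (+ 2) s a) ⟩
    (s + a) * + 2      ∎)
  y≡ : y ≡ s - a
  y≡ = begin
    y                  ≡⟨ solve 2 (λ x y → y := (x :+ y) :- x) refl x y ⟩
    (x + y) - x        ≡⟨ cong₂ _-_ sum≡ x≡ ⟩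
    s * + 2 - (s + a)  ≡⟨ solve 2 (λ s a → s :* con (+ 2) :- (s :+ a) := s :- a) refl s a ⟩
    s - a              ∎

IsHCF-unique : {P : ℕ → Set} {g h : ℕ} → IsHCF P h → (∀ x → P x → g ∣ x) → h ∣ g → g ≡ h
IsHCF-unique {g = zero}  (_ , greatest) g∣P h∣g = contradiction (greatest _ everything-∣P) (ℕ.n≮n _)
  where
  everything-∣P : ∀ x → _ → suc _ ∣ x
  everything-∣P x Px = subst (_ ∣_) (sym (0∣⇒≡0 (g∣P x Px))) (_ ∣0)
IsHCF-unique {g = suc g} (_ , greatest) g∣P h∣g = ℕ.≤-antisym (greatest _ g∣P) (∣⇒≤ h∣g)

isInj₁ : {A B : Set} → A ⊎ B → Bool
isInj₁ = [ const true , const false ]′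

module _ {N X Y : ℕ} where

  consTo : (b : Bool) → (Fin N → Fin X ⊎ Fin Y) →
           Fin (suc N) → Fin (indicator b ℕ.+ X) ⊎ Fin (indicator (not b) ℕ.+ Y)
  consTo true  g zero    = inj₁ zero
  consTo false g zero    = inj₂ zero
  consTo true  g (suc i) = Sum.map₁ suc (g i)
  consTo false g (suc i) = Sum.map₂ suc (g i)

  consFrom : (b : Bool) → (Fin X ⊎ Fin Y → Fin N) →
             Fin (indicator b ℕ.+ X) ⊎ Fin (indicator (not b) ℕ.+ Y) → Fin (suc N)
  consFrom true  h (inj₁ zero)    = zero
  consFrom true  h (inj₁ (suc x)) = suc (h (inj₁ x))
  consFrom true  h (inj₂ y)       = suc (h (inj₂ y))
  consFrom false h (inj₁ x)       = suc (h (inj₁ x))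
  consFrom false h (inj₂ zero)    = zero
  consFrom false h (inj₂ (suc y)) = suc (h (inj₂ y))

  consFrom-consTo : ∀ b {g h} → (∀ i → h (g i) ≡ i) → ∀ i → consFrom b h (consTo b g i) ≡ i
  consFrom-consTo true  hg zero    = refl
  consFrom-consTo false hg zero    = refl
  consFrom-consTo true  {g} hg (suc i) with g i | hg i
  ... | inj₁ x | eq = cong suc eq
  ... | inj₂ y | eq = cong suc eq
  consFrom-consTo false {g} hg (suc i) with g i | hg i
  ... | inj₁ x | eq = cong suc eq
  ... | inj₂ y | eq = cong suc eq

  consTo-consFrom : ∀ b {g h} → (∀ x → g (h x) ≡ x) → ∀ x → consTo b g (consFrom b h x) ≡ x
  consTo-consFrom true  gh (inj₁ zero)    = refl
  consTo-consFrom true  gh (inj₁ (suc x)) = cong (Sum.map₁ suc) (gh (inj₁ x))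
  consTo-consFrom true  gh (inj₂ y)       = cong (Sum.map₁ suc) (gh (inj₂ y))
  consTo-consFrom false gh (inj₁ x)       = cong (Sum.map₂ suc) (gh (inj₁ x))
  consTo-consFrom false gh (inj₂ zero)    = refl
  consTo-consFrom false gh (inj₂ (suc y)) = cong (Sum.map₂ suc) (gh (inj₂ y))

  isInj₁-consTo-zero : ∀ b g → isInj₁ (consTo b g zero) ≡ b
  isInj₁-consTo-zero true  g = refl
  isInj₁-consTo-zero false g = refl

  isInj₁-consTo-suc : ∀ b g i → isInj₁ (consTo b g (suc i)) ≡ isInj₁ (g i)
  isInj₁-consTo-suc true  g i with g i
  ... | inj₁ _ = refl
  ... | inj₂ _ = refl
  isInj₁-consTo-suc false g i with g i
  ... | inj₁ _ = refl
  ... | inj₂ _ = refl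

sortByColour : {N : ℕ} (f : Fin N → Bool) →
               Σ[ σ ∈ Fin N ↔ (Fin (count f) ⊎ Fin (count (not ∘ f))) ] isInj₁ ∘ Inverse.to σ ≗ f
sortByColour {zero}  f = mk↔ₛ′ to from to-from (λ ()) , λ ()
  where
  to : Fin 0 → Fin 0 ⊎ Fin 0
  to ()
  from : Fin 0 ⊎ Fin 0 → Fin 0
  from (inj₁ ())
  from (inj₂ ())
  to-from : ∀ x → to (from x) ≡ x
  to-from (inj₁ ())
  to-from (inj₂ ())
sortByColour {suc N} f =
  mk↔ₛ′ (consTo (f zero) to) (consFrom (f zero) from)
        (consTo-consFrom (f zero) strictlyInverseˡ) (consFrom-consTo (f zero) strictlyInverseʳ) ,
  colour
  where
  σ,colour = sortByColour (f ∘ suc)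
  open Inverse (proj₁ σ,colour)
  colour : isInj₁ ∘ consTo (f zero) to ≗ f
  colour zero    = isInj₁-consTo-zero (f zero) to
  colour (suc i) = trans (isInj₁-consTo-suc (f zero) to i) (proj₂ σ,colour i)

inFirst-join : (p q : ℕ) (x : Fin p ⊎ Fin q) → inFirst {p} {q} (join p q x) ≡ isInj₁ x
inFirst-join zero    q (inj₂ y)       = refl
inFirst-join (suc p) q (inj₁ zero)    = refl
inFirst-join (suc p) q (inj₁ (suc x)) = inFirst-join p q (inj₁ x)
inFirst-join (suc p) q (inj₂ y)       = inFirst-join p q (inj₂ y)

colourings : (N : ℕ) → List (Fin N → Bool)
colourings zero    = [ V.[] ]
colourings (suc N) = map (true V.∷_) (colourings N) ++ map (false V.∷_) (colourings N)

∷-≗ : {N : ℕ} {b : Bool} {g : Fin N → Bool} {f : Fin (suc N) → Bool} →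
      b ≡ f zero → g ≗ f ∘ suc → (b V.∷ g) ≗ f
∷-≗ b≡ g≗ zero    = b≡
∷-≗ b≡ g≗ (suc i) = g≗ i

colourings-complete : {N : ℕ} (c : Fin N → Bool) → Any (_≗ c) (colourings N)
colourings-complete {zero}  c = here (λ ())
colourings-complete {suc N} c with c zero in c₀
... | true  = Any.++⁺ˡ (Any.map⁺ (Any.map (∷-≗ (sym c₀)) (colourings-complete (c ∘ suc))))
... | false = Any.++⁺ʳ (map (true V.∷_) (colourings N))
                       (Any.map⁺ (Any.map (∷-≗ (sym c₀)) (colourings-complete (c ∘ suc))))

module _ (H : Graph) where

  -- Packing K(p, q) along proper colourings

  ProperColouring : Set
  ProperColouring = Σ (Fin (order H) → Bool) (Proper2 H)

  classTotal : (Bool → Bool) → List ProperColouring → ℕ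
  classTotal g = sum ∘ map (λ c → count (g ∘ proj₁ c))

  classTotal-id+not : ∀ cs → classTotal id cs ℕ.+ classTotal not cs ≡ length cs ℕ.* order H
  classTotal-id+not []       = refl
  classTotal-id+not (c ∷ cs) =
    trans (+-interchange (count (proj₁ c)) (classTotal id cs) (count (not ∘ proj₁ c)) (classTotal not cs))
          (cong₂ ℕ._+_ (count+count-not (proj₁ c)) (classTotal-id+not cs))

  concatColouring : (cs : List ProperColouring) → Fin (length cs ℕ.* order H) → Bool
  concatColouring []       ()
  concatColouring (c ∷ cs) i = [ proj₁ c , concatColouring cs ]′ (splitAt (order H) i)

  concatColouring-combine : (cs : List ProperColouring) (j : Fin (length cs)) (u : Fin (order H)) →
                            concatColouring cs (combine j u) ≡ proj₁ (List.lookup cs j) u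
  concatColouring-combine (c ∷ cs) zero    u =
    cong [ proj₁ c , concatColouring cs ]′ (splitAt-↑ˡ (order H) u _)
  concatColouring-combine (c ∷ cs) (suc j) u =
    trans (cong [ proj₁ c , concatColouring cs ]′ (splitAt-↑ʳ (order H) _ (combine j u)))
          (concatColouring-combine cs j u)

  count-concatColouring : (g : Bool → Bool) (cs : List ProperColouring) →
                          count (g ∘ concatColouring cs) ≡ classTotal g cs
  count-concatColouring g []       = refl
  count-concatColouring g (c ∷ cs) = trans (count-↑ (order H) (g ∘ concatColouring (c ∷ cs)))
    (cong₂ ℕ._+_ (count-cong (λ u → cong (g ∘ [ proj₁ c , concatColouring cs ]′) (splitAt-↑ˡ (order H) u _)))
                 (trans (count-cong (λ i → cong (g ∘ [ proj₁ c , concatColouring cs ]′) (splitAt-↑ʳ (order H) _ i)))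
                        (count-concatColouring g cs)))

  packing : (cs : List ProperColouring) → PerfectPacking H (K (classTotal id cs) (classTotal not cs))
  packing cs = subst₂ (PerfectPacking H ∘₂ K) (count-concatColouring id cs) (count-concatColouring not cs)
    (length cs , copy , copy-edge , copy-injective , copy-surjective)
    where
    B = concatColouring cs
    P = count B
    Q = count (not ∘ B)
    σ,colour = sortByColour B
    open Inverse (proj₁ σ,colour)
    copy : Fin (length cs) → Fin (order H) → Fin (P ℕ.+ Q)
    copy j u = join P Q (to (combine j u))
    copy-colour : ∀ j u → inFirst {P} {Q} (copy j u) ≡ proj₁ (List.lookup cs j) u
    copy-colour j u =
      trans (inFirst-join P Q (to (combine j u))) (trans (proj₂ σ,colour _) (concatColouring-combine cs j u))
    copy-edge : ∀ j u v → Edge H u v → Edge (K P Q) (copy j u) (copy j v)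
    copy-edge j u v uv = subst₂ (λ x y → x xor y ≡ true) (sym (copy-colour j u)) (sym (copy-colour j v))
                                (xor-≢ (proj₂ (List.lookup cs j) u v uv))
    copy-injective : ∀ i j u v → copy i u ≡ copy j v → (i ≡ j) × (u ≡ v)
    copy-injective i j u v eq = combine-injective i u j v (begin
      combine i u                 ≡⟨ sym (strictlyInverseʳ _) ⟩
      from (to (combine i u))     ≡⟨ cong from (trans (sym (splitAt-join P Q _)) (cong (splitAt P) eq)) ⟩
      from (splitAt P (copy j v)) ≡⟨ cong from (splitAt-join P Q _) ⟩
      from (to (combine j v))     ≡⟨ strictlyInverseʳ _ ⟩
      combine j v                 ∎)
      where open ≡-Reasoning
    copy-surjective : ∀ w → ∃[ j ] ∃[ u ] copy j u ≡ w
    copy-surjective w = proj₁ ju , proj₂ ju , (begin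
      join P Q (to (combine (proj₁ ju) (proj₂ ju)))
        ≡⟨ cong (join P Q ∘ to) (combine-remQuot {length cs} (order H) _) ⟩
      join P Q (to (from (splitAt P w)))  ≡⟨ cong (join P Q) (strictlyInverseˡ _) ⟩
      join P Q (splitAt P w)              ≡⟨ join-splitAt P Q w ⟩
      w                                   ∎)
      where
      open ≡-Reasoning
      ju = remQuot {length cs} (order H) (from (splitAt P w))

  -- Signed sums of excesses

  complement : ProperColouring → ProperColouring
  complement c = not ∘ proj₁ c , λ u v uv eq → proj₂ c u v uv (Bool.not-injective eq)

  excess : List ProperColouring → ℤ
  excess cs = + classTotal id cs - + classTotal not cs

  excess-[_] : (c : ProperColouring) → excess [ c ] ≡ + count (proj₁ c) - + count (not ∘ proj₁ c)
  excess-[ c ] =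
    cong₂ (λ x y → + x - + y) (ℕ.+-identityʳ (count (proj₁ c))) (ℕ.+-identityʳ (count (not ∘ proj₁ c)))

  classTotal-++ : ∀ g cs ds → classTotal g (cs ++ ds) ≡ classTotal g cs ℕ.+ classTotal g ds
  classTotal-++ g cs ds = trans (cong sum (map-++ count-g cs ds)) (sum-++ (map count-g cs) (map count-g ds))
    where
    count-g : ProperColouring → ℕ
    count-g c = count (g ∘ proj₁ c)

  excess-++ : ∀ cs ds → excess (cs ++ ds) ≡ excess cs + excess ds
  excess-++ cs ds = begin
    + classTotal id (cs ++ ds) - + classTotal not (cs ++ ds)
      ≡⟨ cong₂ (λ x y → + x - + y) (classTotal-++ id cs ds) (classTotal-++ not cs ds) ⟩
    + (T₁ ℕ.+ T₂) - + (F₁ ℕ.+ F₂)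
      ≡⟨ cong₂ _-_ (ℤ.pos-+ T₁ T₂) (ℤ.pos-+ F₁ F₂) ⟩
    (+ T₁ + + T₂) - (+ F₁ + + F₂)
      ≡⟨ solve 4 (λ t₁ t₂ f₁ f₂ → (t₁ :+ t₂) :- (f₁ :+ f₂) := (t₁ :- f₁) :+ (t₂ :- f₂))
               refl (+ T₁) (+ T₂) (+ F₁) (+ F₂) ⟩
    excess cs + excess ds ∎
    where
    open ≡-Reasoning
    open +-*-Solver
    T₁ = classTotal id cs
    T₂ = classTotal id ds
    F₁ = classTotal not cs
    F₂ = classTotal not ds

  classTotal-complement : ∀ g cs → classTotal g (map complement cs) ≡ classTotal (g ∘ not) cs
  classTotal-complement g []       = refl
  classTotal-complement g (c ∷ cs) = cong (count (g ∘ not ∘ proj₁ c) ℕ.+_) (classTotal-complement g cs)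

  classTotal-cong : ∀ {g h} → g ≗ h → ∀ cs → classTotal g cs ≡ classTotal h cs
  classTotal-cong g≗h []       = refl
  classTotal-cong g≗h (c ∷ cs) = cong₂ ℕ._+_ (count-cong (g≗h ∘ proj₁ c)) (classTotal-cong g≗h cs)

  excess-complement : ∀ cs → excess (map complement cs) ≡ - excess cs
  excess-complement cs = begin
    + classTotal id (map complement cs) - + classTotal not (map complement cs)
      ≡⟨ cong₂ (λ x y → + x - + y)
               (classTotal-complement id cs)
               (trans (classTotal-complement not cs) (classTotal-cong Bool.not-involutive cs)) ⟩
    + classTotal not cs - + classTotal id cs
      ≡⟨ solve 2 (λ t f → f :- t := :- (t :- f)) refl (+ classTotal id cs) (+ classTotal not cs) ⟩
    - excess cs ∎
    where
    open ≡-Reasoning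
    open +-*-Solver

  Rep : ℤ → ℕ → Set
  Rep x ℓ = Σ[ cs ∈ List ProperColouring ] excess cs ≡ x × length cs ≡ ℓ

  castᴿ : ∀ {x y ℓ} → x ≡ y → Rep x ℓ → Rep y ℓ
  castᴿ {ℓ = ℓ} = subst (λ z → Rep z ℓ)

  [_]ᴿ : (c : ProperColouring) → Rep (excess [ c ]) 1
  [ c ]ᴿ = [ c ] , refl , refl

  infixr 5 _++ᴿ_
  infixr 7 _×ᴿ_ _·ᴿ_

  _++ᴿ_ : ∀ {x y ℓ ℓ′} → Rep x ℓ → Rep y ℓ′ → Rep (x + y) (ℓ ℕ.+ ℓ′)
  (cs , refl , refl) ++ᴿ (ds , refl , refl) = cs ++ ds , excess-++ cs ds , length-++ cs

  -ᴿ_ : ∀ {x ℓ} → Rep x ℓ → Rep (- x) ℓ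
  -ᴿ (cs , refl , refl) = map complement cs , excess-complement cs , length-map complement cs

  _×ᴿ_ : ∀ {x ℓ} (k : ℕ) → Rep x ℓ → Rep (+ k * x) (k ℕ.* ℓ)
  zero  ×ᴿ r = [] , refl , refl
  suc k ×ᴿ r = castᴿ (sym (ℤ.suc-* (+ k) _)) (r ++ᴿ k ×ᴿ r)

  _·ᴿ_ : ∀ {x ℓ} (k : ℤ) → Rep x ℓ → Rep (k * x) (∣ k ∣ ℕ.* ℓ)
  + k      ·ᴿ r = k ×ᴿ r
  -[1+ k ] ·ᴿ r = castᴿ (ℤ.neg-distribˡ-* (+ suc k) _) (-ᴿ (suc k ×ᴿ r))

  ∣_∣ᴿ : ∀ {x ℓ} → Rep x ℓ → Rep (+ ∣ x ∣) ℓ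
  ∣_∣ᴿ {+ k}      r = r
  ∣_∣ᴿ { -[1+ k ]} r = -ᴿ r

  gcdᴿ : ∀ {a b ℓ ℓ′} → Rep (+ a) ℓ → Rep (+ b) ℓ′ → ∃[ ℓ″ ] Rep (+ gcd a b) ℓ″
  gcdᴿ {a} {b} ra rb with Bézout.lemma a b
  ... | Bézout.result d g (Bézout.+- x y eq) rewrite GCD.unique g (gcd-GCD a b) =
    _ , castᴿ (bezout-combination {u = x} {a} {y} {b} eq) (x ×ᴿ ra ++ᴿ -ᴿ (y ×ᴿ rb))
  ... | Bézout.result d g (Bézout.-+ x y eq) rewrite GCD.unique g (gcd-GCD a b) =
    _ , castᴿ (bezout-combination {u = y} {b} {x} {a} eq) (y ×ᴿ rb ++ᴿ -ᴿ (x ×ᴿ ra))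

  -- hcf_χ(H) = 2 makes 2 a signed sum of excesses

  proper? : (c : Fin (order H) → Bool) → Dec (Proper2 H c)
  proper? c = all? λ u → all? λ v → (adj H u v Bool.≟ true) →-dec ¬? (c u Bool.≟ c v)

  Proper2-≗ : {c c′ : Fin (order H) → Bool} → c ≗ c′ → Proper2 H c′ → Proper2 H c
  Proper2-≗ c≗c′ proper u v uv eq = proper u v uv (trans (sym (c≗c′ u)) (trans eq (c≗c′ v)))

  keepProper : List (Fin (order H) → Bool) → List ProperColouring
  keepProper []       = []
  keepProper (c ∷ cs) with proper? c
  ... | yes proper = (c , proper) ∷ keepProper cs
  ... | no  _      = keepProper cs

  keepProper-complete : ∀ {cs} (c : ProperColouring) →
                        Any (_≗ proj₁ c) cs → Any ((_≗ proj₁ c) ∘ proj₁) (keepProper cs)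
  keepProper-complete {c′ ∷ cs} c (here c′≗c) with proper? c′
  ... | yes _        = here c′≗c
  ... | no  improper = contradiction (Proper2-≗ c′≗c (proj₂ c)) improper
  keepProper-complete {c′ ∷ cs} c (there c∈cs) with proper? c′
  ... | yes _ = there (keepProper-complete c c∈cs)
  ... | no  _ = keepProper-complete c c∈cs

  properColourings : List ProperColouring
  properColourings = keepProper (colourings (order H))

  properColourings-complete : (c : ProperColouring) → Any ((_≗ proj₁ c) ∘ proj₁) properColourings
  properColourings-complete c = keepProper-complete c (colourings-complete (proj₁ c))

  classDiff-cong : {c c′ : Fin (order H) → Bool} → c ≗ c′ → classDiff H c ≡ classDiff H c′
  classDiff-cong c≗c′ =
    cong₂ ℕ.∣_-_∣ (count-cong c≗c′) (count-cong (cong (if_then false else true) ∘ c≗c′))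

  classDiff≡∣excess∣ : (c : ProperColouring) → classDiff H (proj₁ c) ≡ ∣ excess [ c ] ∣
  classDiff≡∣excess∣ c = begin
    ℕ.∣ count (proj₁ c) - count (λ i → if proj₁ c i then false else true) ∣
      ≡⟨ cong (ℕ.∣ count (proj₁ c) -_∣) (count-cong (if≡not ∘ proj₁ c)) ⟩
    ℕ.∣ count (proj₁ c) - count (not ∘ proj₁ c) ∣
      ≡⟨ sym (∣[+m]-[+n]∣≡∣m-n∣ (count (proj₁ c)) (count (not ∘ proj₁ c))) ⟩
    ∣ + count (proj₁ c) - + count (not ∘ proj₁ c) ∣
      ≡⟨ cong ∣_∣ (sym excess-[ c ]) ⟩
    ∣ excess [ c ] ∣ ∎
    where
    open ≡-Reasoning
    if≡not : ∀ b → (if b then false else true) ≡ not b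
    if≡not true  = refl
    if≡not false = refl

  gcdClassDiff : List ProperColouring → ℕ
  gcdClassDiff []       = 0
  gcdClassDiff (c ∷ cs) = gcd (classDiff H (proj₁ c)) (gcdClassDiff cs)

  gcdClassDiffᴿ : ∀ cs → ∃[ ℓ ] Rep (+ gcdClassDiff cs) ℓ
  gcdClassDiffᴿ []       = 0 , [] , refl , refl
  gcdClassDiffᴿ (c ∷ cs) =
    gcdᴿ (castᴿ (cong +_ (sym (classDiff≡∣excess∣ c))) ∣ [ c ]ᴿ ∣ᴿ) (proj₂ (gcdClassDiffᴿ cs))

  gcdClassDiff-∣ : ∀ {cs c} → Any ((_≗ c) ∘ proj₁) cs → gcdClassDiff cs ∣ classDiff H c
  gcdClassDiff-∣ {d ∷ cs} (here d≗c) =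
    subst (gcdClassDiff (d ∷ cs) ∣_) (classDiff-cong d≗c) (gcd[m,n]∣m (classDiff H (proj₁ d)) (gcdClassDiff cs))
  gcdClassDiff-∣ {d ∷ cs} (there c∈cs) =
    ∣-trans (gcd[m,n]∣n (classDiff H (proj₁ d)) (gcdClassDiff cs)) (gcdClassDiff-∣ c∈cs)

  ∣-gcdClassDiff : ∀ {k} → (∀ c → k ∣ classDiff H (proj₁ c)) → ∀ cs → k ∣ gcdClassDiff cs
  ∣-gcdClassDiff k∣ []       = _ ∣0
  ∣-gcdClassDiff k∣ (c ∷ cs) = gcd-greatest (k∣ c) (∣-gcdClassDiff k∣ cs)

  two-representable : HcfChi H 2 → ∃[ N ] Rep (+ 2) N
  two-representable hcf@(2∣D , _) = subst (λ g → ∃[ N ] Rep (+ g) N) gcd≡2 (gcdClassDiffᴿ properColourings)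
    where
    gcd≡2 : gcdClassDiff properColourings ≡ 2
    gcd≡2 = IsHCF-unique hcf
      (λ { _ (c , proper , refl) → gcdClassDiff-∣ (properColourings-complete (c , proper)) })
      (∣-gcdClassDiff (λ c → 2∣D _ (proj₁ c , proj₂ c , refl)) properColourings)

  -- hcf_c(H) = 1 makes 2 a signed sum of an even number of excesses

  module _ (S : Subset (order H)) (closed : ∀ u w → u ∈ S → Edge H u w → w ∈ S) where

    lookup-closed : ∀ {u v} → Edge H u v → lookup S u ≡ true → lookup S v ≡ true
    lookup-closed {u} {v} uv Su = []=⇒lookup (closed u v (lookup⇒[]= u S Su) uv)

    lookup-edge : ∀ {u v} → Edge H u v → lookup S u ≡ lookup S v
    lookup-edge {u} {v} uv = Bool.⇔→≡ (mk⇔ (lookup-closed uv) (lookup-closed (trans (adj-sym H v u) uv)))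

    flipOn : ProperColouring → ProperColouring
    flipOn c = (λ i → proj₁ c i xor lookup S i) , λ u v uv eq →
      proj₂ c u v uv (xor-cancelʳ (lookup S u) (trans eq (cong (proj₁ c v xor_) (sym (lookup-edge uv)))))

  -- Decided over the finite list of proper colourings: if no d qualifies, then flipping c₀ on
  -- a component S shows that |S| is even.
  odd-pair : HcfC H 1 → (c₀ : ProperColouring) → ∃[ d ] parity (count (proj₁ c₀) ℕ.+ count (proj₁ d)) ≡ 1ℙ
  odd-pair (_ , greatest) c₀ with Any.any? (λ d → parity (count (proj₁ c₀) ℕ.+ count (proj₁ d)) ℙ.≟ 1ℙ)
                                           properColourings
  ... | yes odd  = Any.satisfied odd
  ... | no  none = contradiction (greatest 2 components-even) (ℕ.n≮n 1)
    where
    components-even : ∀ x → ComponentOrder H x → 2 ∣ x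
    components-even _ (S , (_ , closed , _) , refl) = parity≡0ℙ⇒2∣ (size S) even
      where
      flipped : ProperColouring
      flipped = flipOn S closed c₀
      even : parity (size S) ≡ 0ℙ
      even with parity (size S) in odd
      ... | 0ℙ = refl
      ... | 1ℙ = contradiction (Any.map (λ {d} → flipped-odd {d}) (properColourings-complete flipped)) none
        where
        flipped-odd : ∀ {d : ProperColouring} → proj₁ d ≗ proj₁ flipped →
                      parity (count (proj₁ c₀) ℕ.+ count (proj₁ d)) ≡ 1ℙ
        flipped-odd {d} d≗ = begin
          parity (count (proj₁ c₀) ℕ.+ count (proj₁ d))
            ≡⟨ cong (λ k → parity (count (proj₁ c₀) ℕ.+ k)) (count-cong d≗) ⟩
          parity (count (proj₁ c₀) ℕ.+ count (proj₁ flipped))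
            ≡⟨ parity-count+count-xor (proj₁ c₀) (lookup S) ⟩
          parity (count (lookup S))  ≡⟨ cong parity (sym (size≡count S)) ⟩
          parity (size S)            ≡⟨ odd ⟩
          1ℙ                         ∎
          where open ≡-Reasoning

  excess-balanced : ∀ c d → excess [ c ] - excess [ d ] + (+ count (proj₁ d) - + count (proj₁ c)) * + 2 ≡ 0ℤ
  excess-balanced c d = begin
    excess [ c ] - excess [ d ] + (+ A′ - + A) * + 2
      ≡⟨ cong₂ (λ x y → x - y + (+ A′ - + A) * + 2) excess-[ c ] excess-[ d ] ⟩
    (+ A - + B) - (+ A′ - + B′) + (+ A′ - + A) * + 2
      ≡⟨ solve 4 (λ a b a′ b′ → (a :- b) :- (a′ :- b′) :+ (a′ :- a) :* con (+ 2) := (a′ :+ b′) :- (a :+ b))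
               refl (+ A) (+ B) (+ A′) (+ B′) ⟩
    (+ A′ + + B′) - (+ A + + B)
      ≡⟨ sym (cong₂ _-_ (ℤ.pos-+ A′ B′) (ℤ.pos-+ A B)) ⟩
    + (A′ ℕ.+ B′) - + (A ℕ.+ B)
      ≡⟨ cong (λ k → + k - + (A ℕ.+ B)) (trans (count+count-not (proj₁ d)) (sym (count+count-not (proj₁ c)))) ⟩
    + (A ℕ.+ B) - + (A ℕ.+ B)
      ≡⟨ ℤ.+-inverseʳ (+ (A ℕ.+ B)) ⟩
    0ℤ ∎
    where
    open ≡-Reasoning
    open +-*-Solver
    A = count (proj₁ c)
    B = count (not ∘ proj₁ c)
    A′ = count (proj₁ d)
    B′ = count (not ∘ proj₁ d)

  zero-sum-of-parity : ∀ {N} → Rep (+ 2) N → (c d : ProperColouring) →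
                       parity (count (proj₁ c) ℕ.+ count (proj₁ d)) ≡ 1ℙ →
                       ∃[ ℓ ] Rep 0ℤ ℓ × parity ℓ ≡ parity N
  zero-sum-of-parity {N} two c d odd =
    2 ℕ.+ ∣ + A′ - + A ∣ ℕ.* N , castᴿ (excess-balanced c d) zero-sum , length-parity
    where
    open ≡-Reasoning
    A = count (proj₁ c)
    A′ = count (proj₁ d)
    zero-sum = ([ c ]ᴿ ++ᴿ -ᴿ [ d ]ᴿ) ++ᴿ (+ A′ - + A) ·ᴿ two
    length-parity : parity (2 ℕ.+ ∣ + A′ - + A ∣ ℕ.* N) ≡ parity N
    length-parity = begin
      parity (∣ + A′ - + A ∣ ℕ.* N)       ≡⟨ ℙ.*-homo-* ∣ + A′ - + A ∣ N ⟩
      parity ∣ + A′ - + A ∣ ℙ.* parity N  ≡⟨ cong (λ k → parity k ℙ.* parity N) (∣[+m]-[+n]∣≡∣m-n∣ A′ A) ⟩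
      parity ℕ.∣ A′ - A ∣ ℙ.* parity N    ≡⟨ cong (ℙ._* parity N) (parity-∣m-n∣ A′ A) ⟩
      parity (A′ ℕ.+ A) ℙ.* parity N      ≡⟨ cong (λ k → parity k ℙ.* parity N) (ℕ.+-comm A′ A) ⟩
      parity (A ℕ.+ A′) ℙ.* parity N      ≡⟨ cong (ℙ._* parity N) odd ⟩
      parity N                            ∎

  two-representable-evenly : Chi≡2 H → HcfC H 1 → HcfChi H 2 → ∃[ e ] Rep (+ 2) (e ℕ.* 2)
  two-representable-evenly (_ , c₀) hcfc hcfχ =
    let N , two            = two-representable hcfχ
        d , odd            = odd-pair hcfc c₀
        ℓ , zero-sum , ℓ≡N = zero-sum-of-parity two c₀ d odd
        divides e N+ℓ≡e*2  = parity≡⇒2∣m+n N ℓ (sym ℓ≡N)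
    in e , subst₂ Rep (ℤ.+-identityʳ (+ 2)) N+ℓ≡e*2 (two ++ᴿ zero-sum)

  packing-from-Rep : ∀ {a m p q} → Rep (a * + 2) (m ℕ.* 2) →
                     + p ≡ + (m ℕ.* order H) + a → + q ≡ + (m ℕ.* order H) - a → PerfectPacking H (K p q)
  packing-from-Rep {a} {m} (cs , excess≡ , length≡) p≡ q≡ =
    subst₂ (PerfectPacking H ∘₂ K) (ℤ.+-injective (trans T≡ (sym p≡))) (ℤ.+-injective (trans F≡ (sym q≡)))
           (packing cs)
    where
    open ≡-Reasoning
    n = order H
    T = classTotal id cs
    F = classTotal not cs
    total : + T + + F ≡ + (m ℕ.* n) * + 2
    total = begin
      + T + + F            ≡⟨ sym (ℤ.pos-+ T F) ⟩
      + (T ℕ.+ F)          ≡⟨ cong +_ (classTotal-id+not cs) ⟩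
      + (length cs ℕ.* n)  ≡⟨ cong (λ ℓ → + (ℓ ℕ.* n)) length≡ ⟩
      + (m ℕ.* 2 ℕ.* n)    ≡⟨ cong +_ (*-rightComm m 2 n) ⟩
      + (m ℕ.* n ℕ.* 2)    ≡⟨ ℤ.pos-* (m ℕ.* n) 2 ⟩
      + (m ℕ.* n) * + 2    ∎
    T≡ : + T ≡ + (m ℕ.* n) + a
    T≡ = proj₁ (solve-sum-difference {+ T} {+ F} {+ (m ℕ.* n)} {a} total excess≡)
    F≡ : + F ≡ + (m ℕ.* n) - a
    F≡ = proj₂ (solve-sum-difference {+ T} {+ F} {+ (m ℕ.* n)} {a} total excess≡)

  padded-multiple : ∀ {e m} (a : ℤ) → ProperColouring → Rep (+ 2) (e ℕ.* 2) → ∣ a ∣ ℕ.* e ≤ m →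
                    Rep (a * + 2) (m ℕ.* 2)
  padded-multiple {e} {m} a c two ∣a∣e≤m =
    subst₂ Rep (trans (cong (_+_ (a * + 2)) (ℤ.*-zeroʳ (+ r))) (ℤ.+-identityʳ (a * + 2))) length≡
           (a ·ᴿ two ++ᴿ r ×ᴿ complementary-pair)
    where
    open ≡-Reasoning
    r = m ℕ.∸ ∣ a ∣ ℕ.* e
    complementary-pair : Rep 0ℤ 2
    complementary-pair = castᴿ (ℤ.+-inverseʳ (excess [ c ])) ([ c ]ᴿ ++ᴿ -ᴿ [ c ]ᴿ)
    length≡ : ∣ a ∣ ℕ.* (e ℕ.* 2) ℕ.+ r ℕ.* 2 ≡ m ℕ.* 2
    length≡ = begin
      ∣ a ∣ ℕ.* (e ℕ.* 2) ℕ.+ r ℕ.* 2  ≡⟨ cong (ℕ._+ r ℕ.* 2) (sym (ℕ.*-assoc ∣ a ∣ e 2)) ⟩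
      ∣ a ∣ ℕ.* e ℕ.* 2 ℕ.+ r ℕ.* 2    ≡⟨ sym (ℕ.*-distribʳ-+ 2 (∣ a ∣ ℕ.* e) r) ⟩
      (∣ a ∣ ℕ.* e ℕ.+ r) ℕ.* 2        ≡⟨ cong (ℕ._* 2) (ℕ.m+[n∸m]≡n ∣a∣e≤m) ⟩
      m ℕ.* 2                          ∎

lemma16 : (H : Graph) → Chi≡2 H → HcfC H 1 → HcfChi H 2 →
    Σ ℕ λ D₀ → ∀ (D′ : ℕ) → D₀ ≤ D′ → order H ∣ D′ →
    ∀ (a : ℤ) → ∣ a ∣ ≤ order H →
    ∀ (p q : ℕ) → + p ≡ + D′ + a → + q ≡ + D′ - a →
    PerfectPacking H (K p q)
lemma16 H χ≡2@((u , _) , c , proper) hcfc hcfχ = e ℕ.* n ℕ.* n , packing-for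
  where
  n = order H
  instance
    n≢0 : ℕ.NonZero n
    n≢0 = nonZeroIndex u
  e,two = two-representable-evenly H χ≡2 hcfc hcfχ
  e = proj₁ e,two
  packing-for : ∀ D′ → e ℕ.* n ℕ.* n ≤ D′ → n ∣ D′ → ∀ a → ∣ a ∣ ≤ n →
                ∀ p q → + p ≡ + D′ + a → + q ≡ + D′ - a → PerfectPacking H (K p q)
  packing-for _ en²≤mn (divides m refl) a ∣a∣≤n p q p≡ q≡ =
    packing-from-Rep H {a} {m} (padded-multiple H a (c , proper) (proj₂ e,two) ∣a∣e≤m) p≡ q≡
    where
    ∣a∣e≤m : ∣ a ∣ ℕ.* e ≤ m
    ∣a∣e≤m = ℕ.≤-trans (ℕ.*-monoˡ-≤ e ∣a∣≤n)
                       (subst (_≤ m) (ℕ.*-comm e n) (ℕ.*-cancelʳ-≤ (e ℕ.* n) m n en²≤mn))
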